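{- Fix $\ell\ge1$ and $\ell$-tuples of non-negative integers $\vec\alpha,\vec\beta$, and let $\hat e_1=(1,0,\dots,0)$. Then $$\sum_{m=0}^\infty M^\ell_m(\vec\alpha,\vec\beta,t)=M^\ell_0(\vec\alpha,\vec\beta,t)+t\,M^\ell_0(\vec\alpha,\vec\beta,t)\,M^\ell_0(\vec\beta+\hat e_1,\vec\beta,t).$$
   Context: An order-$\ell$ Motzkin path of length $n$ and height $m$ is an integer lattice path from $(0,0)$ to $(n,m)$ using steps $U=(1,1)$ and $D_i=(1,-i)$ for $0\le i\le \ell$, never going below $y=0$. For $\ell$-tuples of non-negative integers $\vec\alpha=(\alpha_0,\dots,\alpha_{\ell-1}),\vec\beta=(\beta_0,\dots,\beta_{\ell-1})$, an $(\vec\alpha,\vec\beta)$-colored Motzkin path is such a path in which, for each $0\le i\le \ell-1$, each $D_i$ step whose right endpoint is at height $0$ is labeled by one of $\alpha_i$ colors and each $D_i$ step whose right endpoint is at height $>0$ is labeled by one of $\beta_i$ colors; $U$ and $D_\ell$ steps are unlabeled. $M^\ell_{n,m}(\vec\alpha,\vec\beta)$ is the number of such colored paths of length $n$ and height $m$, and $M^\ell_m(\vec\alpha,\vec\beta,t)=\sum_{n\ge0}M^\ell_{n,m}(\vec\alpha,\vec\beta)t^n$. -}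

module Defs where

open import Data.Nat using (ℕ; zero; suc; _+_; _*_; _∸_)
open import Data.Fin using (Fin; toℕ)
import Data.Fin as F

sumFin : ∀ {k} → (Fin k → ℕ) → ℕ
sumFin {zero}  f = 0
sumFin {suc k} f = f F.zero + sumFin (λ i → f (F.suc i))

-- colour count for a D_i step (0 ≤ i ≤ ℓ-1) whose right endpoint is at height h
colours : ∀ {ℓ} → (α β : Fin ℓ → ℕ) → ℕ → Fin ℓ → ℕ
colours α β zero    i = α i
colours α β (suc _) i = β i

-- Mℓ_{n,m}(α,β): number of (α,β)-coloured order-ℓ Motzkin paths from (0,0)
-- to (n,m) never going below y = 0 (heights are natural numbers).
-- Counted by decomposing on the last step, which ends at height m:
--   U   from height m-1 (only if m ≥ 1), unlabeled;
--   D_i from height m+i (0 ≤ i ≤ ℓ-1), with colours α i (m = 0) or β i (m > 0);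
--   D_ℓ from height m+ℓ, unlabeled.
M : (ℓ : ℕ) → (α β : Fin ℓ → ℕ) → ℕ → ℕ → ℕ
M ℓ α β zero    zero    = 1
M ℓ α β zero    (suc m) = 0
M ℓ α β (suc n) m =
  up m + sumFin (λ i → M ℓ α β n (m + toℕ i) * colours α β m i) + M ℓ α β n (m + ℓ)
  where
  up : ℕ → ℕ
  up zero    = 0
  up (suc h) = M ℓ α β n h

addE1 : ∀ {ℓ} → (Fin ℓ → ℕ) → Fin ℓ → ℕ
addE1 β F.zero    = suc (β F.zero)
addE1 β (F.suc i) = β (F.suc i)

tConv : (A B : ℕ → ℕ) → ℕ → ℕ
tConv A B zero    = 0
tConv A B (suc n) = sumFin {suc n} (λ k → A (toℕ k) * B (n ∸ toℕ k))

module Submission where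

-- Write Mₘ for the generating function of paths ending at height m, H = M₀(β,β) and
-- N = M₀(β+ê₁,β). Cutting a path that ends at height m+1 at its last up step from height m
-- gives Mₘ₊₁ = t Mₘ H, so X = Σₘ Mₘ solves X = M₀ + t X H. Cutting a path counted by N at
-- its last flat step at height 0 carrying the extra colour gives N = H + t N H, and then
-- X = M₀ + t M₀ N solves the same equation. Its solution is unique, since it determines
-- the coefficients of X recursively.

open import Defs
open import Data.Nat using (ℕ; zero; suc; _+_; _*_; _∸_; _≤_; _<_; z≤n; s≤s)
open import Data.Nat.Properties
open import Data.Fin as Fin using (Fin; toℕ)
open import Data.Fin.Properties using (toℕ≤pred[n])
open import Function using (_∘_)
open import Relation.Binary.PropositionalEquality
open import Algebra.Properties.Semiring.Sum +-*-semiring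
open import Algebra.Properties.CommutativeSemigroup +-commutativeSemigroup
  using (x∙yz≈y∙xz; interchange)
open ≡-Reasoning

sumFin≡sum : ∀ {k} (f : Fin k → ℕ) → sumFin f ≡ sum f
sumFin≡sum {zero}  f = refl
sumFin≡sum {suc k} f = cong (f Fin.zero +_) (sumFin≡sum (f ∘ Fin.suc))

Series : Set
Series = ℕ → ℕ

infixl 7 _⋆_

_⋆_ : Series → Series → Series
(f ⋆ g) n = ∑[ k ≤ n ] (f (toℕ k) * g (n ∸ toℕ k))

t· : Series → Series
t· f zero    = 0
t· f (suc n) = f n

tConv≡t·⋆ : ∀ f g n → tConv f g n ≡ t· (f ⋆ g) n
tConv≡t·⋆ f g zero    = refl
tConv≡t·⋆ f g (suc n) = sumFin≡sum {suc n} (λ k → f (toℕ k) * g (n ∸ toℕ k))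

⋆-unfoldˡ : ∀ f g n → (f ⋆ g) n ≡ f 0 * g n + t· (f ∘ suc ⋆ g) n
⋆-unfoldˡ f g zero    = refl
⋆-unfoldˡ f g (suc n) = refl

⋆-unfoldʳ : ∀ f g n → (f ⋆ g) n ≡ f n * g 0 + t· (f ⋆ g ∘ suc) n
⋆-unfoldʳ f g zero    = refl
⋆-unfoldʳ f g (suc n) = begin
  f 0 * g (suc n) + (f ∘ suc ⋆ g) n
    ≡⟨ cong (f 0 * g (suc n) +_) (⋆-unfoldʳ (f ∘ suc) g n) ⟩
  f 0 * g (suc n) + (f (suc n) * g 0 + t· (f ∘ suc ⋆ g ∘ suc) n)
    ≡⟨ x∙yz≈y∙xz (f 0 * g (suc n)) (f (suc n) * g 0) _ ⟩
  f (suc n) * g 0 + (f 0 * g (suc n) + t· (f ∘ suc ⋆ g ∘ suc) n)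
    ≡⟨ cong (f (suc n) * g 0 +_) (sym (⋆-unfoldˡ f (g ∘ suc) n)) ⟩
  f (suc n) * g 0 + (f ⋆ g ∘ suc) n ∎

⋆-shiftˡ : ∀ f g n → (t· f ⋆ g) n ≡ t· (f ⋆ g) n
⋆-shiftˡ f g zero    = refl
⋆-shiftˡ f g (suc n) = refl

⋆-shiftʳ : ∀ f g n → (f ⋆ t· g) n ≡ t· (f ⋆ g) n
⋆-shiftʳ f g n = trans (⋆-unfoldʳ f (t· g) n) (cong (_+ t· (f ⋆ g) n) (*-zeroʳ (f n)))

⋆-congˡ : ∀ {f f′} g n → (∀ k → k ≤ n → f k ≡ f′ k) → (f ⋆ g) n ≡ (f′ ⋆ g) n
⋆-congˡ g n eq =
  sum-cong-≗ {suc n} (λ k → cong (_* g (n ∸ toℕ k)) (eq (toℕ k) (toℕ≤pred[n] k)))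

⋆-congʳ : ∀ f {g g′} n → (∀ k → g k ≡ g′ k) → (f ⋆ g) n ≡ (f ⋆ g′) n
⋆-congʳ f n eq = sum-cong-≗ {suc n} (λ k → cong (f (toℕ k) *_) (eq (n ∸ toℕ k)))

⋆-distribʳ-+ : ∀ f g h n → ((λ k → f k + g k) ⋆ h) n ≡ (f ⋆ h) n + (g ⋆ h) n
⋆-distribʳ-+ f g h n = trans
  (sum-cong-≗ {suc n} (λ k → *-distribʳ-+ (h (n ∸ toℕ k)) (f (toℕ k)) (g (toℕ k))))
  (∑-distrib-+ {suc n} (λ k → f (toℕ k) * h (n ∸ toℕ k)) (λ k → g (toℕ k) * h (n ∸ toℕ k)))

⋆-distribˡ-+ : ∀ f g h n → (f ⋆ (λ k → g k + h k)) n ≡ (f ⋆ g) n + (f ⋆ h) n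
⋆-distribˡ-+ f g h n = trans
  (sum-cong-≗ {suc n} (λ k → *-distribˡ-+ (f (toℕ k)) (g (n ∸ toℕ k)) (h (n ∸ toℕ k))))
  (∑-distrib-+ {suc n} (λ k → f (toℕ k) * g (n ∸ toℕ k)) (λ k → f (toℕ k) * h (n ∸ toℕ k)))

⋆-*ˡ : ∀ c f g n → ((λ k → c * f k) ⋆ g) n ≡ c * (f ⋆ g) n
⋆-*ˡ c f g n = trans (sum-cong-≗ {suc n} (λ k → *-assoc c (f (toℕ k)) (g (n ∸ toℕ k))))
  (sym (*-distribˡ-sum {suc n} c (λ k → f (toℕ k) * g (n ∸ toℕ k))))

⋆-*ʳ : ∀ f g c n → (f ⋆ (λ k → g k * c)) n ≡ (f ⋆ g) n * c
⋆-*ʳ f g c n = trans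
  (sum-cong-≗ {suc n} (λ k → sym (*-assoc (f (toℕ k)) (g (n ∸ toℕ k)) c)))
  (sym (*-distribʳ-sum {suc n} c (λ k → f (toℕ k) * g (n ∸ toℕ k))))

⋆-zeroʳ : ∀ f n → (f ⋆ (λ _ → 0)) n ≡ 0
⋆-zeroʳ f n =
  trans (sum-cong-≗ {suc n} (λ k → *-zeroʳ (f (toℕ k)))) (sum-replicate-zero (suc n))

⋆-∑ˡ : ∀ {m} (F : Fin m → Series) g n →
  ((λ k → ∑[ i < m ] F i k) ⋆ g) n ≡ ∑[ i < m ] (F i ⋆ g) n
⋆-∑ˡ F g n = trans
  (sum-cong-≗ {suc n} (λ k → *-distribʳ-sum (g (n ∸ toℕ k)) (λ i → F i (toℕ k))))
  (∑-comm {suc n} (λ k i → F i (toℕ k) * g (n ∸ toℕ k)))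

⋆-∑ʳ : ∀ {m} f (G : Fin m → Series) n →
  (f ⋆ (λ k → ∑[ i < m ] G i k)) n ≡ ∑[ i < m ] (f ⋆ G i) n
⋆-∑ʳ f G n = trans
  (sum-cong-≗ {suc n} (λ k → *-distribˡ-sum (f (toℕ k)) (λ i → G i (n ∸ toℕ k))))
  (∑-comm {suc n} (λ k i → f (toℕ k) * G i (n ∸ toℕ k)))

⋆-assoc : ∀ f g h n → ((f ⋆ g) ⋆ h) n ≡ (f ⋆ (g ⋆ h)) n
⋆-assoc f g h n = begin
  ((f ⋆ g) ⋆ h) n
    ≡⟨ ⋆-congˡ h n (λ k _ → ⋆-unfoldˡ f g k) ⟩
  ((λ k → f 0 * g k + t· (f ∘ suc ⋆ g) k) ⋆ h) n
    ≡⟨ ⋆-distribʳ-+ (λ k → f 0 * g k) (t· (f ∘ suc ⋆ g)) h n ⟩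
  ((λ k → f 0 * g k) ⋆ h) n + (t· (f ∘ suc ⋆ g) ⋆ h) n
    ≡⟨ cong₂ _+_ (⋆-*ˡ (f 0) g h n) (⋆-shiftˡ (f ∘ suc ⋆ g) h n) ⟩
  f 0 * (g ⋆ h) n + t· ((f ∘ suc ⋆ g) ⋆ h) n
    ≡⟨ cong (f 0 * (g ⋆ h) n +_) (tail-assoc n) ⟩
  f 0 * (g ⋆ h) n + t· (f ∘ suc ⋆ (g ⋆ h)) n
    ≡⟨ sym (⋆-unfoldˡ f (g ⋆ h) n) ⟩
  (f ⋆ (g ⋆ h)) n ∎
  where
  tail-assoc : ∀ n → t· ((f ∘ suc ⋆ g) ⋆ h) n ≡ t· (f ∘ suc ⋆ (g ⋆ h)) n
  tail-assoc zero    = refl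
  tail-assoc (suc n) = ⋆-assoc (f ∘ suc) g h n

gf : ∀ {ℓ} → (α β : Fin ℓ → ℕ) → ℕ → Series
gf {ℓ} α β m n = M ℓ α β n m

-- The last step into height m is an up step from height m − 1 (counted by below) or a
-- down step Dᵢ from height m + i (counted by downs, with cᵢ colours for i < ℓ).
below : (ℕ → ℕ) → ℕ → ℕ
below P zero    = 0
below P (suc h) = P h

downs : ∀ {ℓ} → (Fin ℓ → ℕ) → (ℕ → ℕ) → ℕ → ℕ
downs {ℓ} c P m = ∑[ i < ℓ ] (P (m + toℕ i) * c i) + P (m + ℓ)

M-suc : ∀ {ℓ} (α β : Fin ℓ → ℕ) n m →
  M ℓ α β (suc n) m ≡ below (M ℓ α β n) m + downs (colours α β m) (M ℓ α β n) m
M-suc {ℓ} α β n zero    = cong (_+ M ℓ α β n ℓ) (sumFin≡sum (λ i → M ℓ α β n (toℕ i) * α i))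
M-suc {ℓ} α β n (suc m) = trans (+-assoc (M ℓ α β n m) _ _)
  (cong (λ s → M ℓ α β n m + (s + M ℓ α β n (suc m + ℓ)))
        (sumFin≡sum (λ i → M ℓ α β n (suc m + toℕ i) * β i)))

colours-diag : ∀ {ℓ} (β : Fin ℓ → ℕ) m → colours β β m ≡ β
colours-diag β zero    = refl
colours-diag β (suc m) = refl

downs-cong : ∀ {ℓ} (c : Fin ℓ → ℕ) {P Q} m →
  (∀ h → m ≤ h → P h ≡ Q h) → downs c P m ≡ downs c Q m
downs-cong {ℓ} c m eq =
  cong₂ _+_ (sum-cong-≗ {ℓ} (λ i → cong (_* c i) (eq _ (m≤m+n m (toℕ i))))) (eq _ (m≤m+n m ℓ))

downs-reindex : ∀ {ℓ} (c : Fin ℓ → ℕ) P k m → downs c P (k + m) ≡ downs c (λ h → P (k + h)) m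
downs-reindex {ℓ} c P k m = cong₂ _+_
  (sum-cong-≗ {ℓ} (λ i → cong (λ h → P h * c i) (+-assoc k m (toℕ i))))
  (cong P (+-assoc k m ℓ))

downs-zero : ∀ {ℓ} (c : Fin ℓ → ℕ) m → downs c (λ _ → 0) m ≡ 0
downs-zero {ℓ} c m = trans (+-identityʳ _) (sum-replicate-zero ℓ)

downs-+ : ∀ {ℓ} (c : Fin ℓ → ℕ) P Q m →
  downs c (λ h → P h + Q h) m ≡ downs c P m + downs c Q m
downs-+ {ℓ} c P Q m = trans
  (cong (_+ (P (m + ℓ) + Q (m + ℓ)))
    (trans (sum-cong-≗ {ℓ} (λ i → *-distribʳ-+ (c i) (P (m + toℕ i)) (Q (m + toℕ i))))
           (∑-distrib-+ (λ i → P (m + toℕ i) * c i) (λ i → Q (m + toℕ i) * c i))))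
  (interchange (∑[ i < ℓ ] (P (m + toℕ i) * c i)) (∑[ i < ℓ ] (Q (m + toℕ i) * c i))
               (P (m + ℓ)) (Q (m + ℓ)))

downs-addE1 : ∀ {ℓ} (c : Fin (suc ℓ) → ℕ) P m → downs (addE1 c) P m ≡ P m + downs c P m
downs-addE1 {ℓ} c P m = begin
  (x * suc (c Fin.zero) + rest) + last  ≡⟨ cong (λ y → (y + rest) + last) (*-suc x (c Fin.zero)) ⟩
  ((x + x * c Fin.zero) + rest) + last  ≡⟨ cong (_+ last) (+-assoc x _ rest) ⟩
  (x + (x * c Fin.zero + rest)) + last  ≡⟨ +-assoc x _ last ⟩
  x + downs c P m                       ≡⟨ cong (λ h → P h + downs c P m) (+-identityʳ m) ⟩
  P m + downs c P m                     ∎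
  where
  x    = P (m + 0)
  rest = ∑[ i < ℓ ] (P (m + toℕ (Fin.suc i)) * c (Fin.suc i))
  last = P (m + suc ℓ)

⋆-below : ∀ f (G : ℕ → Series) m n →
  (f ⋆ (λ j → below (λ h → G h j) m)) n ≡ below (λ h → (f ⋆ G h) n) m
⋆-below f G zero    n = ⋆-zeroʳ f n
⋆-below f G (suc m) n = refl

⋆-downs : ∀ {ℓ} f (c : Fin ℓ → ℕ) (G : ℕ → Series) m n →
  (f ⋆ (λ j → downs c (λ h → G h j) m)) n ≡ downs c (λ h → (f ⋆ G h) n) m
⋆-downs {ℓ} f c G m n = trans
  (⋆-distribˡ-+ f (λ j → ∑[ i < ℓ ] (G (m + toℕ i) j * c i)) (G (m + ℓ)) n)
  (cong (_+ (f ⋆ G (m + ℓ)) n)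
    (trans (⋆-∑ʳ f (λ i j → G (m + toℕ i) j * c i) n)
           (sum-cong-≗ {ℓ} (λ i → ⋆-*ʳ f (G (m + toℕ i)) (c i) n))))

t·⋆-gf-suc : ∀ {ℓ} (α β : Fin ℓ → ℕ) f d n →
  t· (f ⋆ gf α β d ∘ suc) n
    ≡ below (λ h → t· (f ⋆ gf α β h) n) d + downs (colours α β d) (λ h → t· (f ⋆ gf α β h) n) d
t·⋆-gf-suc α β f zero    zero    = sym (downs-zero α 0)
t·⋆-gf-suc α β f (suc d) zero    = sym (downs-zero β (suc d))
t·⋆-gf-suc α β f d       (suc n) = begin
  (f ⋆ gf α β d ∘ suc) n                 ≡⟨ ⋆-congʳ f n (λ j → M-suc α β j d) ⟩
  (f ⋆ (λ j → B j + D j)) n              ≡⟨ ⋆-distribˡ-+ f B D n ⟩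
  (f ⋆ B) n + (f ⋆ D) n                  ≡⟨ cong₂ _+_ (⋆-below f (gf α β) d n) (⋆-downs f c (gf α β) d n) ⟩
  below (λ h → (f ⋆ gf α β h) n) d + downs c (λ h → (f ⋆ gf α β h) n) d ∎
  where
  c = colours α β d
  B D : Series
  B j = below (λ h → gf α β h j) d
  D j = downs c (λ h → gf α β h j) d

-- Cut the path at its last up step from height m.
gf-suc-+ : ∀ {ℓ} (α β : Fin ℓ → ℕ) m d n →
  gf α β (suc (m + d)) n ≡ t· (gf α β m ⋆ gf β β d) n
gf-suc-+ α β m d zero    = refl
gf-suc-+ {ℓ} α β m d (suc n) = begin
  M ℓ α β (suc n) (suc (m + d))
    ≡⟨ M-suc α β n (suc (m + d)) ⟩
  M ℓ α β n (m + d) + downs β (M ℓ α β n) (suc m + d)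
    ≡⟨ cong₂ _+_ (below-part d) downs-part ⟩
  F n * P d 0 + below T d + downs β T d
    ≡⟨ +-assoc (F n * P d 0) (below T d) (downs β T d) ⟩
  F n * P d 0 + (below T d + downs β T d)
    ≡⟨ cong (λ c → F n * P d 0 + (below T d + downs c T d)) (sym (colours-diag β d)) ⟩
  F n * P d 0 + (below T d + downs (colours β β d) T d)
    ≡⟨ cong (F n * P d 0 +_) (sym (t·⋆-gf-suc β β F d n)) ⟩
  F n * P d 0 + t· (F ⋆ P d ∘ suc) n
    ≡⟨ sym (⋆-unfoldʳ F (P d) n) ⟩
  (F ⋆ P d) n ∎
  where
  F = gf α β m
  P = gf β β
  T : ℕ → ℕ
  T h = t· (F ⋆ P h) n
  below-part : ∀ d → M ℓ α β n (m + d) ≡ F n * P d 0 + below T d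
  below-part zero    = trans (cong (M ℓ α β n) (+-identityʳ m))
    (sym (trans (+-identityʳ _) (*-identityʳ (F n))))
  below-part (suc d) = trans (cong (M ℓ α β n) (+-suc m d))
    (trans (gf-suc-+ α β m d n) (sym (cong (_+ T d) (*-zeroʳ (F n)))))
  downs-part : downs β (M ℓ α β n) (suc m + d) ≡ downs β T d
  downs-part = trans (downs-reindex β (M ℓ α β n) (suc m) d)
    (downs-cong β d (λ h _ → gf-suc-+ α β m h n))

M-addE1-suc : ∀ {ℓ} (α β : Fin (suc ℓ) → ℕ) n d →
  M (suc ℓ) (addE1 α) β (suc n) d
    ≡ M (suc ℓ) (addE1 α) β n 0 * M (suc ℓ) α β 0 d
      + (below (M (suc ℓ) (addE1 α) β n) d + downs (colours α β d) (M (suc ℓ) (addE1 α) β n) d)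
M-addE1-suc {ℓ} α β n zero = begin
  M′ (suc n) 0                      ≡⟨ M-suc (addE1 α) β n 0 ⟩
  downs (addE1 α) (M′ n) 0          ≡⟨ downs-addE1 α (M′ n) 0 ⟩
  M′ n 0 + downs α (M′ n) 0         ≡⟨ cong (_+ downs α (M′ n) 0) (sym (*-identityʳ (M′ n 0))) ⟩
  M′ n 0 * 1 + downs α (M′ n) 0     ∎
  where M′ = M (suc ℓ) (addE1 α) β
M-addE1-suc {ℓ} α β n (suc d) = trans (M-suc (addE1 α) β n (suc d))
  (sym (cong (_+ (below (M′ n) (suc d) + downs β (M′ n) (suc d))) (*-zeroʳ (M′ n 0))))
  where M′ = M (suc ℓ) (addE1 α) β

-- Cut the path at its last flat step at height 0 carrying the extra colour.
gf-addE1 : ∀ {ℓ} (α β : Fin (suc ℓ) → ℕ) d n →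
  gf (addE1 α) β d n ≡ gf α β d n + t· (gf (addE1 α) β 0 ⋆ gf α β d) n
gf-addE1 α β zero    zero = refl
gf-addE1 α β (suc d) zero = refl
gf-addE1 {ℓ} α β d (suc n) = begin
  Mα′ (suc n) d
    ≡⟨ M-addE1-suc α β n d ⟩
  N n * M₀ + (below (Mα′ n) d + downs c (Mα′ n) d)
    ≡⟨ cong (N n * M₀ +_) (cong₂ _+_ (below-part d) downs-part) ⟩
  N n * M₀ + ((below (Mα n) d + below T d) + (downs c (Mα n) d + downs c T d))
    ≡⟨ cong (N n * M₀ +_) (interchange (below (Mα n) d) (below T d) (downs c (Mα n) d) (downs c T d)) ⟩
  N n * M₀ + ((below (Mα n) d + downs c (Mα n) d) + (below T d + downs c T d))
    ≡⟨ x∙yz≈y∙xz (N n * M₀) (below (Mα n) d + downs c (Mα n) d) (below T d + downs c T d) ⟩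
  (below (Mα n) d + downs c (Mα n) d) + (N n * M₀ + (below T d + downs c T d))
    ≡⟨ cong₂ _+_ (sym (M-suc α β n d)) (cong (N n * M₀ +_) (sym (t·⋆-gf-suc α β N d n))) ⟩
  Mα (suc n) d + (N n * M₀ + t· (N ⋆ gf α β d ∘ suc) n)
    ≡⟨ cong (Mα (suc n) d +_) (sym (⋆-unfoldʳ N (gf α β d) n)) ⟩
  Mα (suc n) d + (N ⋆ gf α β d) n ∎
  where
  Mα′ = M (suc ℓ) (addE1 α) β
  Mα  = M (suc ℓ) α β
  N  = gf (addE1 α) β 0
  M₀ = Mα 0 d
  c  = colours α β d
  T : ℕ → ℕ
  T h = t· (N ⋆ gf α β h) n
  below-part : ∀ d → below (Mα′ n) d ≡ below (Mα n) d + below T d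
  below-part zero    = refl
  below-part (suc d) = gf-addE1 α β d n
  downs-part : downs c (Mα′ n) d ≡ downs c (Mα n) d + downs c T d
  downs-part = trans (downs-cong c d (λ h _ → gf-addE1 α β h n)) (downs-+ c (Mα n) T d)

M-vanish : ∀ {ℓ} (α β : Fin ℓ → ℕ) n m → n < m → M ℓ α β n m ≡ 0
M-vanish α β zero    (suc m) _ = refl
M-vanish {ℓ} α β (suc n) (suc m) (s≤s n<m) = begin
  M ℓ α β (suc n) (suc m)                  ≡⟨ M-suc α β n (suc m) ⟩
  M ℓ α β n m + downs β (M ℓ α β n) (suc m)
    ≡⟨ cong₂ _+_ (M-vanish α β n m n<m)
                 (downs-cong β (suc m) (λ h m<h → M-vanish α β n h (<-trans n<m m<h))) ⟩
  downs β (λ _ → 0) (suc m)                ≡⟨ downs-zero β (suc m) ⟩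
  0                                        ∎

∑-vanishing-tail : ∀ b c (f : ℕ → ℕ) → (∀ m → b ≤ m → f m ≡ 0) →
  ∑[ i < b + c ] (f (toℕ i)) ≡ ∑[ i < b ] (f (toℕ i))
∑-vanishing-tail zero    c f tail0 =
  trans (sum-cong-≗ {c} (λ i → tail0 (toℕ i) z≤n)) (sum-replicate-zero c)
∑-vanishing-tail (suc b) c f tail0 =
  cong (f 0 +_) (∑-vanishing-tail b c (f ∘ suc) (λ m b≤m → tail0 (suc m) (s≤s b≤m)))

allHeights : ∀ {ℓ} → (α β : Fin ℓ → ℕ) → Series
allHeights {ℓ} α β n = ∑[ m ≤ n ] (M ℓ α β n (toℕ m))

allHeights-truncate : ∀ {ℓ} (α β : Fin ℓ → ℕ) {k n} →
  k ≤ n → ∑[ m ≤ n ] (M ℓ α β k (toℕ m)) ≡ allHeights α β k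
allHeights-truncate {ℓ} α β {k} {n} k≤n = trans
  (cong (λ b → ∑[ m < b ] (M ℓ α β k (toℕ m))) (sym (m+[n∸m]≡n (s≤s k≤n))))
  (∑-vanishing-tail (suc k) (n ∸ k) (M ℓ α β k) (M-vanish α β k))

allHeights-rec : ∀ {ℓ} (α β : Fin ℓ → ℕ) n →
  allHeights α β n ≡ gf α β 0 n + t· (allHeights α β ⋆ gf β β 0) n
allHeights-rec α β zero    = refl
allHeights-rec {ℓ} α β (suc n) = cong (M ℓ α β (suc n) 0 +_) (begin
  ∑[ m ≤ n ] (M ℓ α β (suc n) (suc (toℕ m)))
    ≡⟨ sum-cong-≗ {suc n} (λ m →
         trans (cong (λ h → M ℓ α β (suc n) (suc h)) (sym (+-identityʳ (toℕ m))))
               (gf-suc-+ α β (toℕ m) 0 (suc n))) ⟩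
  ∑[ m ≤ n ] ((gf α β (toℕ m) ⋆ H) n)
    ≡⟨ sym (⋆-∑ˡ {suc n} (λ m → gf α β (toℕ m)) H n) ⟩
  ((λ k → ∑[ m ≤ n ] (gf α β (toℕ m) k)) ⋆ H) n
    ≡⟨ ⋆-congˡ H n (λ k k≤n → allHeights-truncate α β k≤n) ⟩
  (allHeights α β ⋆ H) n ∎)
  where H = gf β β 0

t·⋆-fixpoint-unique : ∀ (a h x y : Series) →
  (∀ n → x n ≡ a n + t· (x ⋆ h) n) → (∀ n → y n ≡ a n + t· (y ⋆ h) n) →
  ∀ n → x n ≡ y n
t·⋆-fixpoint-unique a h x y x-fix y-fix n = agree n n ≤-refl
  where
  agree : ∀ n k → k ≤ n → x k ≡ y k
  agree n       zero    _         = trans (x-fix 0) (sym (y-fix 0))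
  agree (suc n) (suc k) (s≤s k≤n) = begin
    x (suc k)
      ≡⟨ x-fix (suc k) ⟩
    a (suc k) + (x ⋆ h) k
      ≡⟨ cong (a (suc k) +_) (⋆-congˡ h k (λ j j≤k → agree n j (≤-trans j≤k k≤n))) ⟩
    a (suc k) + (y ⋆ h) k
      ≡⟨ sym (y-fix (suc k)) ⟩
    y (suc k) ∎

-- In closed form r = h / (1 − t h), and both sides are a / (1 − t h).
t·⋆-resolvent : ∀ (a h r : Series) → (∀ n → r n ≡ h n + t· (r ⋆ h) n) →
  ∀ n → a n + t· (a ⋆ r) n ≡ a n + t· ((λ k → a k + t· (a ⋆ r) k) ⋆ h) n
t·⋆-resolvent a h r r-fix zero    = refl
t·⋆-resolvent a h r r-fix (suc n) = cong (a (suc n) +_) (begin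
  (a ⋆ r) n                          ≡⟨ ⋆-congʳ a n r-fix ⟩
  (a ⋆ (λ k → h k + t· (r ⋆ h) k)) n ≡⟨ ⋆-distribˡ-+ a h (t· (r ⋆ h)) n ⟩
  (a ⋆ h) n + (a ⋆ t· (r ⋆ h)) n     ≡⟨ cong ((a ⋆ h) n +_) (⋆-shiftʳ a (r ⋆ h) n) ⟩
  (a ⋆ h) n + t· (a ⋆ (r ⋆ h)) n     ≡⟨ cong ((a ⋆ h) n +_) (tail-assoc n) ⟩
  (a ⋆ h) n + t· ((a ⋆ r) ⋆ h) n     ≡⟨ cong ((a ⋆ h) n +_) (sym (⋆-shiftˡ (a ⋆ r) h n)) ⟩
  (a ⋆ h) n + (t· (a ⋆ r) ⋆ h) n     ≡⟨ sym (⋆-distribʳ-+ a (t· (a ⋆ r)) h n) ⟩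
  ((λ k → a k + t· (a ⋆ r) k) ⋆ h) n ∎)
  where
  tail-assoc : ∀ n → t· (a ⋆ (r ⋆ h)) n ≡ t· ((a ⋆ r) ⋆ h) n
  tail-assoc zero    = refl
  tail-assoc (suc n) = sym (⋆-assoc a r h n)

corollary2p6 : (ℓ : ℕ) → 1 ≤ ℓ → (α β : Fin ℓ → ℕ) → (n : ℕ) →
    sumFin {suc n} (λ m → M ℓ α β n (toℕ m))
      ≡ M ℓ α β n 0 + tConv (λ k → M ℓ α β k 0) (λ j → M ℓ (addE1 β) β j 0) n
corollary2p6 (suc ℓ) (s≤s z≤n) α β n = begin
  sumFin {suc n} (λ m → M (suc ℓ) α β n (toℕ m))
    ≡⟨ sumFin≡sum {suc n} (λ m → M (suc ℓ) α β n (toℕ m)) ⟩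
  allHeights α β n
    ≡⟨ t·⋆-fixpoint-unique A H (allHeights α β) closedForm (allHeights-rec α β)
         (t·⋆-resolvent A H N (gf-addE1 β β 0)) n ⟩
  A n + t· (A ⋆ N) n
    ≡⟨ cong (A n +_) (sym (tConv≡t·⋆ A N n)) ⟩
  A n + tConv A N n ∎
  where
  A = gf α β 0
  H = gf β β 0
  N = gf (addE1 β) β 0
  closedForm : Series
  closedForm k = A k + t· (A ⋆ N) k
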